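{- Let $\mathbb{F}$ be a finite field, $d\ge 2$ and $\epsilon>0$ be fixed, and let $r=r(n)$ satisfy $r\le(1-\epsilon)n/2$. Let $T$ be drawn from $\mathcal{T}^{(r)}_{d,n}(\mathbb{F})$. Then, as $n\to\infty$, $$\mathbb{E}_T\,\mathrm{bias}(T)=(1+o(1))\,|\mathbb{F}|^{ -r}.$$
   Context: A $d$-linear form is a map $T\colon(\mathbb{F}^n)^d\to\mathbb{F}$ linear in each of its $d$ vector variables $x^{(1)},\dots,x^{(d)}$. For such $T$, $\mathrm{bias}(T)=\Pr[T=0]-\Pr[T=y]$ for any nonzero $y\in\mathbb{F}$ (independent of $y$), the probability over a uniformly random point of $(\mathbb{F}^n)^d$. The distribution $\mathcal{T}^{(r)}_{d,n}(\mathbb{F})$ is that of $T=\sum_{i=1}^r S_iR_i$, a sum of $r$ independent random reducible $d$-linear forms: for each $i$ there is a (fixed) nonempty proper subset $I_i\subsetneq[d]$ of the vector variables, and $S_i$, $R_i$ are independent uniformly random multilinear forms in the variables indexed by $I_i$ and by $[d]\setminus I_i$ respectively (i.e., all their coefficients are independent and uniform in $\mathbb{F}$).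
   Formalization: The fixed parameter ε > 0 in the bound $r\le(1-\epsilon)n/2$ ranges over the positive rationals. -}

module Defs where

open import Level using (0ℓ)
open import Data.Bool using (Bool; true; false)
open import Data.Nat as ℕ using (ℕ; zero; suc)
open import Data.Integer using (+_)
open import Data.Rational as Q using (ℚ; _/_; 0ℚ; 1ℚ)
open import Data.Fin using (Fin; zero; suc)
open import Data.Fin.Subset using (Subset; ∁)
open import Data.Vec using ([]; _∷_)
open import Data.Product using (_×_; ∃; proj₁; proj₂)
open import Function using (_∘_)
open import Relation.Nullary using (¬_; yes; no)
open import Relation.Binary.Definitions using (Decidable)
open import Relation.Binary.PropositionalEquality using (_≡_)
open import Algebra.Bundles using (CommutativeRing)

record FiniteField : Set₁ where
  field
    commRing : CommutativeRing 0ℓ 0ℓ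
  open CommutativeRing commRing public
  field
    1≉0       : ¬ (1# ≈ 0#)
    inverse   : ∀ x → ¬ (x ≈ 0#) → ∃ λ y → (x * y) ≈ 1#
    _≟_       : Decidable _≈_
    size-1    : ℕ
    elem      : Fin (suc size-1) → Carrier
    elem-surj : ∀ x → ∃ λ i → elem i ≈ x
    elem-inj  : ∀ i j → elem i ≈ elem j → i ≡ j

  size : ℕ
  size = suc size-1

ℕtoℚ : ℕ → ℚ
ℕtoℚ k = + k / 1

sumℚ : (k : ℕ) → (Fin k → ℚ) → ℚ
sumℚ zero    f = 0ℚ
sumℚ (suc k) f = f zero Q.+ sumℚ k (f ∘ suc)

cons : {X : Set} {a : ℕ} → X → (Fin a → X) → Fin (suc a) → X
cons x h zero    = x
cons x h (suc i) = h i

consD : {r : ℕ} {P : Fin (suc r) → Set} → P zero → ((i : Fin r) → P (suc i)) → (i : Fin (suc r)) → P i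
consD x h zero    = x
consD x h (suc i) = h i

EFn : {X : Set} → ((X → ℚ) → ℚ) → (a : ℕ) → ((Fin a → X) → ℚ) → ℚ
EFn E zero    g = g (λ ())
EFn E (suc a) g = E (λ x → EFn E a (λ h → g (cons x h)))

module _ (𝔽 : FiniteField) where
  open FiniteField 𝔽 using (Carrier; _≈_; _+_; _*_; 0#; 1#; _≟_; size; elem)

  E𝔽 : (Fin size → ℚ) → ℚ
  E𝔽 f = sumℚ size f Q.* (+ 1 / size)

  sum𝔽 : (k : ℕ) → (Fin k → Carrier) → Carrier
  sum𝔽 zero    f = 0#
  sum𝔽 (suc k) f = f zero + sum𝔽 k (f ∘ suc)

  Point : ℕ → ℕ → Set
  Point d n = Fin d → Fin n → Carrier

  -- Coefficient tensor of a multilinear form (over 𝔽^n) in the vector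
  -- variables indexed by the subset p ⊆ [d]: one coefficient in 𝔽 (given by
  -- its index in Fin size) for each multi-index (j_k)_{k ∈ p} ∈ [n]^p.
  Form : (n : ℕ) {d : ℕ} → Subset d → Set
  Form n []          = Fin size
  Form n (true ∷ p)  = Fin n → Form n p
  Form n (false ∷ p) = Form n p

  EForm : (n : ℕ) {d : ℕ} (p : Subset d) → (Form n p → ℚ) → ℚ
  EForm n []          g = E𝔽 g
  EForm n (true ∷ p)  g = EFn (EForm n p) n g
  EForm n (false ∷ p) g = EForm n p g

  -- evaluation  Σ_{(j_k)_{k∈p}} c_{(j_k)} ∏_{k ∈ p} x^{(k)}_{j_k}
  evalForm : (n : ℕ) {d : ℕ} (p : Subset d) → Form n p → Point d n → Carrier
  evalForm n []          c x = elem c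
  evalForm n (true ∷ p)  c x = sum𝔽 n (λ j → x zero j * evalForm n p (c j) (x ∘ suc))
  evalForm n (false ∷ p) c x = evalForm n p c (x ∘ suc)

  EPoint : (d n : ℕ) → (Point d n → ℚ) → ℚ
  EPoint d n g = EFn (EFn E𝔽 n) d (λ x → g (λ k j → elem (x k j)))

  𝟙≈ : Carrier → Carrier → ℚ
  𝟙≈ a b with a ≟ b
  ... | yes _ = 1ℚ
  ... | no  _ = 0ℚ

  -- bias(T) = Pr[T = 0] - Pr[T = y], taken with y = 1
  bias : (d n : ℕ) → (Point d n → Carrier) → ℚ
  bias d n T = EPoint d n (λ x → 𝟙≈ (T x) 0# Q.- 𝟙≈ (T x) 1#)

  Config : (n : ℕ) {d : ℕ} (r : ℕ) → (Fin r → Subset d) → Set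
  Config n r I = (i : Fin r) → Form n (I i) × Form n (∁ (I i))

  EConfig : (n : ℕ) {d : ℕ} (r : ℕ) (I : Fin r → Subset d) → (Config n r I → ℚ) → ℚ
  EConfig n zero    I g = g (λ ())
  EConfig n (suc r) I g =
    EForm n (I zero) (λ s → EForm n (∁ (I zero)) (λ t →
      EConfig n r (I ∘ suc) (λ c → g (consD {P = λ i → Form n (I i) × Form n (∁ (I i))} (s Data.Product., t) c))))

  tensor : (d n r : ℕ) (I : Fin r → Subset d) → Config n r I → Point d n → Carrier
  tensor d n r I c x = sum𝔽 r (λ i → evalForm n (I i) (proj₁ (c i)) x * evalForm n (∁ (I i)) (proj₂ (c i)) x)

  expectedBias : (d n r : ℕ) (I : Fin r → Subset d) → ℚ
  expectedBias d n r I = EConfig n r I (λ c → bias d n (tensor d n r I c))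

{-# OPTIONS --safe #-}
-- Fix a point x = (x⁽¹⁾, …, x⁽ᵈ⁾). If some x⁽ᵏ⁾ is zero, every S_i R_i vanishes at x, so T(x) = 0.
-- Otherwise each S_i(x) and R_i(x) is a nonzero linear combination of independent uniform
-- coefficients, hence uniform, and S_i(x) R_i(x) satisfies Pr[· = c] = B + q⁻¹ [c = 0].
-- Laws of this shape multiply their excess at 0 under independent sums, so
-- Pr[T(x) = c] = B′ + q⁻ʳ [c = 0] and E_T (1[T(x) = 0] − 1[T(x) = 1]) = q⁻ʳ.
-- Averaging over x (after swapping the two expectations) gives the exact formula
-- E bias(T) = 1 + (q⁻ʳ − 1)(1 − q⁻ⁿ)ᵈ, hence qʳ E bias(T) − 1 = (qʳ − 1)(1 − (1 − q⁻ⁿ)ᵈ) ≤ d q⁻⁽ⁿ⁻ʳ⁾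
-- by Bernoulli, and n − r ≥ n/2 makes this small.
module Submission where

open import Defs
open import Data.Nat as ℕ using (ℕ; _^_)
open import Data.Rational using (ℚ; _*_; _-_; _≤_; _<_; ∣_∣; 0ℚ; 1ℚ; ½)
open import Data.Fin using (Fin)
open import Data.Fin.Subset using (Subset; ∁; Nonempty)
open import Data.Product using (_×_; ∃)

open import Algebra.Bundles using (CommutativeRing)
open import Data.Bool using (true; false)
import Data.Fin as Fin
import Data.Fin.Properties as FinP
open import Data.Fin.Subset using (_∈_)
open import Data.Fin.Subset.Properties using (_∈?_; x∉p⇒x∈∁p)
open import Data.Integer as ℤ using (+_; +[1+_]; +≤+)
import Data.Integer.Properties as ℤP
open import Data.Nat using (zero; suc; z≤n; s≤s)
import Data.Nat.Properties as ℕP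
open import Data.Rational as ℚ using (_+_; _/_; -_; toℚᵘ; ↧ₙ_; mkℚ)
import Data.Rational.Properties as ℚP
import Data.Rational.Unnormalised as ℚᵘ
import Data.Rational.Unnormalised.Properties as ℚᵘP
open import Data.Rational.Solver using (module +-*-Solver)
open import Data.Product using (_,_; proj₁; proj₂)
open import Data.Sum using (_⊎_; inj₁; inj₂)
open import Data.Vec using ([]; _∷_; here; there)
open import Relation.Binary.PropositionalEquality
open import Function using (_∘_; _⇔_; mk⇔; Equivalence)
open import Relation.Nullary using (¬_; yes; no; contradiction)
open import Algebra.Properties.Semiring.Exp (CommutativeRing.semiring ℚP.+-*-commutativeRing)
  using () renaming (_^_ to _^ℚ_; ^-homo-* to ^ℚ-homo-+)

open +-*-Solver

toℚᵘ-ℕtoℚ : ∀ k → toℚᵘ (ℕtoℚ k) ℚᵘ.≃ ℚᵘ.mkℚᵘ (+ k) 0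
toℚᵘ-ℕtoℚ k = ℚP.toℚᵘ-fromℚᵘ (ℚᵘ.mkℚᵘ (+ k) 0)

ℕtoℚ-+ : ∀ a b → ℕtoℚ (a ℕ.+ b) ≡ ℕtoℚ a + ℕtoℚ b
ℕtoℚ-+ a b = ℚP.toℚᵘ-injective (begin
  toℚᵘ (ℕtoℚ (a ℕ.+ b))                  ≈⟨ toℚᵘ-ℕtoℚ (a ℕ.+ b) ⟩
  ℚᵘ.mkℚᵘ (+ (a ℕ.+ b)) 0                 ≈⟨ ℚᵘ.*≡* (cong (ℤ._* + 1) numerators) ⟩
  ℚᵘ.mkℚᵘ (+ a) 0 ℚᵘ.+ ℚᵘ.mkℚᵘ (+ b) 0    ≈⟨ ℚᵘP.+-cong (toℚᵘ-ℕtoℚ a) (toℚᵘ-ℕtoℚ b) ⟨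
  toℚᵘ (ℕtoℚ a) ℚᵘ.+ toℚᵘ (ℕtoℚ b)        ≈⟨ ℚP.toℚᵘ-homo-+ (ℕtoℚ a) (ℕtoℚ b) ⟨
  toℚᵘ (ℕtoℚ a + ℕtoℚ b)                  ∎)
  where
  open import Relation.Binary.Reasoning.Setoid ℚᵘP.≃-setoid
  numerators : + (a ℕ.+ b) ≡ + a ℤ.* + 1 ℤ.+ + b ℤ.* + 1
  numerators = cong₂ ℤ._+_ (sym (ℤP.*-identityʳ (+ a))) (sym (ℤP.*-identityʳ (+ b)))

ℕtoℚ-* : ∀ a b → ℕtoℚ (a ℕ.* b) ≡ ℕtoℚ a * ℕtoℚ b
ℕtoℚ-* a b = ℚP.toℚᵘ-injective (begin
  toℚᵘ (ℕtoℚ (a ℕ.* b))                  ≈⟨ toℚᵘ-ℕtoℚ (a ℕ.* b) ⟩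
  ℚᵘ.mkℚᵘ (+ (a ℕ.* b)) 0                 ≈⟨ ℚᵘ.*≡* (cong (ℤ._* + 1) (ℤP.pos-* a b)) ⟩
  ℚᵘ.mkℚᵘ (+ a) 0 ℚᵘ.* ℚᵘ.mkℚᵘ (+ b) 0    ≈⟨ ℚᵘP.*-cong (toℚᵘ-ℕtoℚ a) (toℚᵘ-ℕtoℚ b) ⟨
  toℚᵘ (ℕtoℚ a) ℚᵘ.* toℚᵘ (ℕtoℚ b)        ≈⟨ ℚP.toℚᵘ-homo-* (ℕtoℚ a) (ℕtoℚ b) ⟨
  toℚᵘ (ℕtoℚ a * ℕtoℚ b)                  ∎)
  where open import Relation.Binary.Reasoning.Setoid ℚᵘP.≃-setoid

ℕtoℚ-^ : ∀ a k → ℕtoℚ (a ^ k) ≡ ℕtoℚ a ^ℚ k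
ℕtoℚ-^ a zero    = refl
ℕtoℚ-^ a (suc k) = trans (ℕtoℚ-* a (a ^ k)) (cong (ℕtoℚ a *_) (ℕtoℚ-^ a k))

0≤ℕtoℚ : ∀ k → 0ℚ ≤ ℕtoℚ k
0≤ℕtoℚ k = ℚP.nonNegative⁻¹ (ℕtoℚ k) {{ℚP.normalize-nonNeg k 1}}

ℕtoℚ-mono-≤ : ∀ {a b} → a ℕ.≤ b → ℕtoℚ a ≤ ℕtoℚ b
ℕtoℚ-mono-≤ {a} {b} a≤b = begin
  ℕtoℚ a                    ≡⟨ ℚP.+-identityʳ (ℕtoℚ a) ⟨
  ℕtoℚ a + 0ℚ               ≤⟨ ℚP.+-monoʳ-≤ (ℕtoℚ a) (0≤ℕtoℚ (b ℕ.∸ a)) ⟩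
  ℕtoℚ a + ℕtoℚ (b ℕ.∸ a)   ≡⟨ ℕtoℚ-+ a (b ℕ.∸ a) ⟨
  ℕtoℚ (a ℕ.+ (b ℕ.∸ a))    ≡⟨ cong ℕtoℚ (ℕP.m+[n∸m]≡n a≤b) ⟩
  ℕtoℚ b                    ∎
  where open ℚP.≤-Reasoning

ℕtoℚ-cancel-≤ : ∀ {a b} → ℕtoℚ a ≤ ℕtoℚ b → a ℕ.≤ b
ℕtoℚ-cancel-≤ {a} {b} ℕtoℚa≤ℕtoℚb with a ℕ.≤? b
... | yes a≤b = a≤b
... | no a≰b = contradiction (ℚP.<-≤-trans ℕtoℚb<ℕtoℚa ℕtoℚa≤ℕtoℚb) (ℚP.<-irrefl refl)
  where
  open ℚP.≤-Reasoning
  ℕtoℚb<ℕtoℚa : ℕtoℚ b < ℕtoℚ a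
  ℕtoℚb<ℕtoℚa = begin-strict
    ℕtoℚ b          ≡⟨ ℚP.+-identityˡ (ℕtoℚ b) ⟨
    0ℚ + ℕtoℚ b     <⟨ ℚP.+-monoˡ-< (ℕtoℚ b) (ℚP.positive⁻¹ 1ℚ) ⟩
    1ℚ + ℕtoℚ b     ≡⟨ ℕtoℚ-+ 1 b ⟨
    ℕtoℚ (suc b)    ≤⟨ ℕtoℚ-mono-≤ (ℕP.≰⇒> a≰b) ⟩
    ℕtoℚ a          ∎

ℕtoℚ*1/ : ∀ k .{{_ : ℕ.NonZero k}} → ℕtoℚ k * (+ 1 / k) ≡ 1ℚ
ℕtoℚ*1/ (suc s) = ℚP.toℚᵘ-injective (begin
  toℚᵘ (ℕtoℚ (suc s) * (+ 1 / suc s))           ≈⟨ ℚP.toℚᵘ-homo-* (ℕtoℚ (suc s)) (+ 1 / suc s) ⟩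
  toℚᵘ (ℕtoℚ (suc s)) ℚᵘ.* toℚᵘ (+ 1 / suc s)  ≈⟨ ℚᵘP.*-cong (toℚᵘ-ℕtoℚ (suc s)) (ℚP.toℚᵘ-fromℚᵘ (ℚᵘ.mkℚᵘ (+ 1) s)) ⟩
  ℚᵘ.mkℚᵘ (+ suc s) 0 ℚᵘ.* ℚᵘ.mkℚᵘ (+ 1) s      ≈⟨ ℚᵘ.*≡* numerators ⟩
  ℚᵘ.1ℚᵘ                                        ∎)
  where
  open import Relation.Binary.Reasoning.Setoid ℚᵘP.≃-setoid
  numerators : (+ suc s ℤ.* + 1) ℤ.* + 1 ≡ + 1 ℤ.* + suc (s ℕ.+ 0)
  numerators = trans (ℤP.*-identityʳ _) (trans (ℤP.*-identityʳ _)
                 (trans (cong (λ t → + suc t) (sym (ℕP.+-identityʳ s))) (sym (ℤP.*-identityˡ _))))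

0≤* : ∀ {p q} → 0ℚ ≤ p → 0ℚ ≤ q → 0ℚ ≤ p * q
0≤* {p} {q} 0≤p 0≤q =
  ℚP.nonNegative⁻¹ (p * q) {{ℚP.nonNeg*nonNeg⇒nonNeg p {{ℚ.nonNegative 0≤p}} q {{ℚ.nonNegative 0≤q}}}}

*-monoˡ-≤ : ∀ {r p q} → 0ℚ ≤ r → p ≤ q → r * p ≤ r * q
*-monoˡ-≤ {r} 0≤r = ℚP.*-monoˡ-≤-nonNeg r {{ℚ.nonNegative 0≤r}}

*-monoʳ-≤ : ∀ {r p q} → 0ℚ ≤ r → p ≤ q → p * r ≤ q * r
*-monoʳ-≤ {r} 0≤r = ℚP.*-monoʳ-≤-nonNeg r {{ℚ.nonNegative 0≤r}}

0≤q-p : ∀ {p q} → p ≤ q → 0ℚ ≤ q - p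
0≤q-p {p} {q} p≤q = subst (_≤ q - p) (ℚP.+-inverseʳ p) (ℚP.+-monoˡ-≤ (- p) p≤q)

p-q≤p : ∀ {p q} → 0ℚ ≤ q → p - q ≤ p
p-q≤p {p} {q} 0≤q = subst (p - q ≤_) (ℚP.+-identityʳ p) (ℚP.+-monoʳ-≤ p (ℚP.neg-antimono-≤ 0≤q))

1/-bounds : ∀ k .{{_ : ℕ.NonZero k}} → 0ℚ ≤ + 1 / k × + 1 / k ≤ 1ℚ
1/-bounds (suc s) = 0≤1/k , (begin
  + 1 / suc s                    ≡⟨ ℚP.*-identityˡ _ ⟨
  1ℚ * (+ 1 / suc s)             ≤⟨ *-monoʳ-≤ 0≤1/k (ℕtoℚ-mono-≤ {1} {suc s} (s≤s z≤n)) ⟩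
  ℕtoℚ (suc s) * (+ 1 / suc s)   ≡⟨ ℕtoℚ*1/ (suc s) ⟩
  1ℚ                             ∎)
  where
  open ℚP.≤-Reasoning
  0≤1/k : 0ℚ ≤ + 1 / suc s
  0≤1/k = ℚP.nonNegative⁻¹ _ {{ℚP.normalize-nonNeg 1 (suc s)}}

^ℚ-inverse : ∀ {x y} → x * y ≡ 1ℚ → ∀ k → x ^ℚ k * y ^ℚ k ≡ 1ℚ
^ℚ-inverse {x} {y} xy≡1 zero    = refl
^ℚ-inverse {x} {y} xy≡1 (suc k) = begin
  (x * x ^ℚ k) * (y * y ^ℚ k)   ≡⟨ solve 4 (λ x y a b → (x :* a) :* (y :* b) := (x :* y) :* (a :* b)) refl x y (x ^ℚ k) (y ^ℚ k) ⟩
  (x * y) * (x ^ℚ k * y ^ℚ k)   ≡⟨ cong₂ _*_ xy≡1 (^ℚ-inverse xy≡1 k) ⟩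
  1ℚ                            ∎
  where open ≡-Reasoning

^ℚ-bounds : ∀ {x} → 0ℚ ≤ x → x ≤ 1ℚ → ∀ k → 0ℚ ≤ x ^ℚ k × x ^ℚ k ≤ 1ℚ
^ℚ-bounds 0≤x x≤1 zero    = ℚP.nonNegative⁻¹ 1ℚ , ℚP.≤-refl
^ℚ-bounds {x} 0≤x x≤1 (suc k) = 0≤* 0≤x 0≤xᵏ , (begin
  x * x ^ℚ k   ≤⟨ *-monoˡ-≤ 0≤x xᵏ≤1 ⟩
  x * 1ℚ       ≡⟨ ℚP.*-identityʳ x ⟩
  x            ≤⟨ x≤1 ⟩
  1ℚ           ∎)
  where
  open ℚP.≤-Reasoning
  0≤xᵏ : 0ℚ ≤ x ^ℚ k
  0≤xᵏ = proj₁ (^ℚ-bounds 0≤x x≤1 k)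
  xᵏ≤1 : x ^ℚ k ≤ 1ℚ
  xᵏ≤1 = proj₂ (^ℚ-bounds 0≤x x≤1 k)

bernoulli : ∀ {a} → 0ℚ ≤ a → a ≤ 1ℚ → ∀ k → 1ℚ - (1ℚ - a) ^ℚ k ≤ ℕtoℚ k * a
bernoulli {a} 0≤a a≤1 zero = ℚP.≤-reflexive (solve 1 (λ a → con 1ℚ :- con 1ℚ := con 0ℚ :* a) refl a)
bernoulli {a} 0≤a a≤1 (suc k) = begin
  1ℚ - (1ℚ - a) * p     ≡⟨ solve 2 (λ a p → con 1ℚ :- (con 1ℚ :- a) :* p := (con 1ℚ :- p) :+ a :* p) refl a p ⟩
  (1ℚ - p) + a * p      ≤⟨ ℚP.+-mono-≤ (bernoulli 0≤a a≤1 k) (*-monoˡ-≤ 0≤a p≤1) ⟩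
  ℕtoℚ k * a + a * 1ℚ   ≡⟨ solve 2 (λ k a → k :* a :+ a :* con 1ℚ := (con 1ℚ :+ k) :* a) refl (ℕtoℚ k) a ⟩
  (1ℚ + ℕtoℚ k) * a     ≡⟨ cong (_* a) (ℕtoℚ-+ 1 k) ⟨
  ℕtoℚ (suc k) * a      ∎
  where
  open ℚP.≤-Reasoning
  p : ℚ
  p = (1ℚ - a) ^ℚ k
  p≤1 : p ≤ 1ℚ
  p≤1 = proj₂ (^ℚ-bounds (0≤q-p a≤1) (p-q≤p 0≤a) k)

1≤δ*↧δ : ∀ {δ} → 0ℚ < δ → 1ℚ ≤ δ * ℕtoℚ (↧ₙ δ)
1≤δ*↧δ {δ} 0<δ = go δ (ℚ.positive 0<δ)
  where
  go : ∀ δ → ℚ.Positive δ → 1ℚ ≤ δ * ℕtoℚ (↧ₙ δ)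
  go δ@(mkℚ +[1+ n ] d-1 _) _ = ℚP.toℚᵘ-cancel-≤ (ℚᵘP.≤-respʳ-≃ (ℚᵘP.≃-sym δ*↧δ≃) (ℚᵘ.*≤* (+≤+ nats)))
    where
    δ*↧δ≃ : toℚᵘ (δ * ℕtoℚ (suc d-1)) ℚᵘ.≃ ℚᵘ.mkℚᵘ +[1+ n ] d-1 ℚᵘ.* ℚᵘ.mkℚᵘ (+ suc d-1) 0
    δ*↧δ≃ = ℚᵘP.≃-trans (ℚP.toℚᵘ-homo-* δ (ℕtoℚ (suc d-1))) (ℚᵘP.*-cong ℚᵘP.≃-refl (toℚᵘ-ℕtoℚ (suc d-1)))
    nats : suc (d-1 ℕ.* 1 ℕ.+ 0) ℕ.≤ (suc n ℕ.* suc d-1) ℕ.* 1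
    nats = ℕP.≤-trans (ℕP.≤-reflexive (cong suc (trans (ℕP.+-identityʳ _) (ℕP.*-identityʳ d-1))))
             (ℕP.≤-trans (ℕP.m≤n*m (suc d-1) (suc n)) (ℕP.≤-reflexive (sym (ℕP.*-identityʳ _))))

n<q^n : ∀ {q} → 2 ℕ.≤ q → ∀ n → n ℕ.< q ^ n
n<q^n 2≤q zero = s≤s z≤n
n<q^n {q} 2≤q (suc n) = begin
  suc (suc n)        ≤⟨ ℕP.+-mono-≤ (ℕP.≤-trans (s≤s z≤n) (n<q^n 2≤q n)) (n<q^n 2≤q n) ⟩
  q ^ n ℕ.+ q ^ n    ≡⟨ cong (q ^ n ℕ.+_) (ℕP.+-identityʳ (q ^ n)) ⟨
  2 ℕ.* q ^ n        ≤⟨ ℕP.*-monoˡ-≤ (q ^ n) 2≤q ⟩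
  q ℕ.* q ^ n        ∎
  where open ℕP.≤-Reasoning

c*[1/q]^m≤δ : ∀ {q} .{{_ : ℕ.NonZero q}} → 2 ℕ.≤ q → ∀ c {δ} → 0ℚ < δ →
              ∀ {m} → c ℕ.* ↧ₙ δ ℕ.≤ m → ℕtoℚ c * (+ 1 / q) ^ℚ m ≤ δ
c*[1/q]^m≤δ {q} 2≤q c {δ} 0<δ {m} c*↧δ≤m = begin
  ℕtoℚ c * aᵐ                             ≡⟨ cong (_* aᵐ) (ℚP.*-identityʳ (ℕtoℚ c)) ⟨
  ℕtoℚ c * 1ℚ * aᵐ                        ≤⟨ *-monoʳ-≤ 0≤aᵐ (*-monoˡ-≤ (0≤ℕtoℚ c) (1≤δ*↧δ 0<δ)) ⟩
  ℕtoℚ c * (δ * ℕtoℚ (↧ₙ δ)) * aᵐ         ≡⟨ cong (_* aᵐ) regroup ⟩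
  δ * ℕtoℚ (c ℕ.* ↧ₙ δ) * aᵐ              ≤⟨ *-monoʳ-≤ 0≤aᵐ (*-monoˡ-≤ (ℚP.<⇒≤ 0<δ) (ℕtoℚ-mono-≤ c*↧δ≤qᵐ)) ⟩
  δ * ℕtoℚ (q ^ m) * aᵐ                   ≡⟨ ℚP.*-assoc δ (ℕtoℚ (q ^ m)) aᵐ ⟩
  δ * (ℕtoℚ (q ^ m) * aᵐ)                 ≡⟨ cong (λ t → δ * (t * aᵐ)) (ℕtoℚ-^ q m) ⟩
  δ * (ℕtoℚ q ^ℚ m * aᵐ)                  ≡⟨ cong (δ *_) (^ℚ-inverse (ℕtoℚ*1/ q) m) ⟩
  δ * 1ℚ                                  ≡⟨ ℚP.*-identityʳ δ ⟩
  δ                                       ∎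
  where
  open ℚP.≤-Reasoning
  aᵐ : ℚ
  aᵐ = (+ 1 / q) ^ℚ m
  0≤aᵐ : 0ℚ ≤ aᵐ
  0≤aᵐ = proj₁ (^ℚ-bounds (proj₁ (1/-bounds q)) (proj₂ (1/-bounds q)) m)
  c*↧δ≤qᵐ : c ℕ.* ↧ₙ δ ℕ.≤ q ^ m
  c*↧δ≤qᵐ = ℕP.≤-trans c*↧δ≤m (ℕP.<⇒≤ (n<q^n 2≤q m))
  regroup : ℕtoℚ c * (δ * ℕtoℚ (↧ₙ δ)) ≡ δ * ℕtoℚ (c ℕ.* ↧ₙ δ)
  regroup = trans (solve 3 (λ c δ d → c :* (δ :* d) := δ :* (c :* d)) refl (ℕtoℚ c) δ (ℕtoℚ (↧ₙ δ)))
                  (cong (δ *_) (sym (ℕtoℚ-* c (↧ₙ δ))))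

relativeError-formula : ∀ {Q D P} → Q * D ≡ 1ℚ → (1ℚ + (D - 1ℚ) * P) * Q - 1ℚ ≡ (Q - 1ℚ) * (1ℚ - P)
relativeError-formula {Q} {D} {P} QD≡1 = begin
  (1ℚ + (D - 1ℚ) * P) * Q - 1ℚ              ≡⟨ solve 3 (λ Q D P → (con 1ℚ :+ (D :- con 1ℚ) :* P) :* Q :- con 1ℚ
                                                  := (Q :- con 1ℚ) :* (con 1ℚ :- P) :+ P :* (Q :* D :- con 1ℚ)) refl Q D P ⟩
  (Q - 1ℚ) * (1ℚ - P) + P * (Q * D - 1ℚ)    ≡⟨ cong (λ t → (Q - 1ℚ) * (1ℚ - P) + P * (t - 1ℚ)) QD≡1 ⟩
  (Q - 1ℚ) * (1ℚ - P) + P * (1ℚ - 1ℚ)       ≡⟨ solve 2 (λ X P → X :+ P :* (con 1ℚ :- con 1ℚ) := X) refl ((Q - 1ℚ) * (1ℚ - P)) P ⟩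
  (Q - 1ℚ) * (1ℚ - P)                       ∎
  where open ≡-Reasoning

rate⇒r+r≤n : ∀ {ε} → 0ℚ < ε → ∀ r n → ℕtoℚ r ≤ (1ℚ - ε) * ℕtoℚ n * ½ → r ℕ.+ r ℕ.≤ n
rate⇒r+r≤n {ε} 0<ε r n r≤[1-ε]n/2 = ℕtoℚ-cancel-≤ (begin
  ℕtoℚ (r ℕ.+ r)     ≡⟨ ℕtoℚ-+ r r ⟩
  ℕtoℚ r + ℕtoℚ r    ≤⟨ ℚP.+-mono-≤ r≤n/2 r≤n/2 ⟩
  N * ½ + N * ½      ≡⟨ solve 1 (λ N → N :* con ½ :+ N :* con ½ := N) refl N ⟩
  N                  ∎)
  where
  open ℚP.≤-Reasoning
  N : ℚ
  N = ℕtoℚ n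
  r≤n/2 : ℕtoℚ r ≤ N * ½
  r≤n/2 = begin
    ℕtoℚ r                 ≤⟨ r≤[1-ε]n/2 ⟩
    (1ℚ - ε) * N * ½       ≡⟨ solve 2 (λ ε N → (con 1ℚ :- ε) :* N :* con ½ := N :* con ½ :- ε :* (N :* con ½)) refl ε N ⟩
    N * ½ - ε * (N * ½)    ≤⟨ p-q≤p (0≤* (ℚP.<⇒≤ 0<ε) (0≤* (0≤ℕtoℚ n) (ℚP.nonNegative⁻¹ ½))) ⟩
    N * ½                  ∎

half-≤-∸ : ∀ {K r n} → r ℕ.+ r ℕ.≤ n → 2 ℕ.* K ℕ.≤ n → K ℕ.≤ n ℕ.∸ r
half-≤-∸ {K} {r} {n} r+r≤n 2K≤n = ℕP.*-cancelˡ-≤ 2 (begin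
  2 ℕ.* K      ≤⟨ 2K≤n ⟩
  n            ≡⟨ ℕP.m+[n∸m]≡n r≤n ⟨
  r ℕ.+ m      ≤⟨ ℕP.+-monoˡ-≤ m r≤m ⟩
  m ℕ.+ m      ≡⟨ cong (m ℕ.+_) (ℕP.+-identityʳ m) ⟨
  2 ℕ.* m      ∎)
  where
  open ℕP.≤-Reasoning
  m : ℕ
  m = n ℕ.∸ r
  r≤n : r ℕ.≤ n
  r≤n = ℕP.≤-trans (ℕP.m≤m+n r r) r+r≤n
  r≤m : r ℕ.≤ m
  r≤m = ℕP.+-cancelˡ-≤ r r m (ℕP.≤-trans r+r≤n (ℕP.≤-reflexive (sym (ℕP.m+[n∸m]≡n r≤n))))

Expectation : Set → Set
Expectation X = (X → ℚ) → ℚ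

record IsExpectation {X : Set} (E : Expectation X) : Set where
  field
    ext         : ∀ {f g : X → ℚ} → (∀ x → f x ≡ g x) → E f ≡ E g
    additive    : ∀ f g → E (λ x → f x + g x) ≡ E f + E g
    homogeneous : ∀ c f → E (λ x → c * f x) ≡ c * E f
    const       : ∀ c → E (λ _ → c) ≡ c

  affine : ∀ a b f → E (λ x → a + b * f x) ≡ a + b * E f
  affine a b f = trans (additive (λ _ → a) (λ x → b * f x)) (cong₂ _+_ (const a) (homogeneous b f))

  homogeneousʳ : ∀ c f → E (λ x → f x * c) ≡ E f * c
  homogeneousʳ c f = trans (ext (λ x → ℚP.*-comm (f x) c)) (trans (homogeneous c f) (ℚP.*-comm c (E f)))

  subtractive : ∀ f g → E (λ x → f x - g x) ≡ E f - E g
  subtractive f g = begin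
    E (λ x → f x - g x)            ≡⟨ ext (λ x → -≡-1* (f x) (g x)) ⟩
    E (λ x → f x + (- 1ℚ) * g x)   ≡⟨ additive f (λ x → (- 1ℚ) * g x) ⟩
    E f + E (λ x → (- 1ℚ) * g x)   ≡⟨ cong (_+_ (E f)) (homogeneous (- 1ℚ) g) ⟩
    E f + (- 1ℚ) * E g             ≡⟨ -≡-1* (E f) (E g) ⟨
    E f - E g                      ∎
    where
    open ≡-Reasoning
    -≡-1* : ∀ a b → a - b ≡ a + (- 1ℚ) * b
    -≡-1* = solve 2 (λ a b → a :- b := a :+ (:- con 1ℚ) :* b) refl

open IsExpectation

_⊗_ : ∀ {X Y} → Expectation X → Expectation Y → Expectation (X × Y)
(E₁ ⊗ E₂) g = E₁ (λ x → E₂ (λ y → g (x , y)))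

⊗-isExpectation : ∀ {X Y} {E₁ : Expectation X} {E₂ : Expectation Y} →
                  IsExpectation E₁ → IsExpectation E₂ → IsExpectation (E₁ ⊗ E₂)
⊗-isExpectation isE₁ isE₂ = record
  { ext         = λ f≗g → ext isE₁ (λ x → ext isE₂ (λ y → f≗g (x , y)))
  ; additive    = λ f g → trans (ext isE₁ (λ x → additive isE₂ _ _)) (additive isE₁ _ _)
  ; homogeneous = λ c f → trans (ext isE₁ (λ x → homogeneous isE₂ c _)) (homogeneous isE₁ c _)
  ; const       = λ c → trans (ext isE₁ (λ x → const isE₂ c)) (const isE₁ c)
  }

pushforward : ∀ {X Y} → (X → Y) → Expectation X → Expectation Y
pushforward k E g = E (λ x → g (k x))

pushforward-isExpectation : ∀ {X Y} (k : X → Y) {E : Expectation X} →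
                            IsExpectation E → IsExpectation (pushforward k E)
pushforward-isExpectation k isE = record
  { ext         = λ f≗g → ext isE (λ x → f≗g (k x))
  ; additive    = λ f g → additive isE _ _
  ; homogeneous = λ c f → homogeneous isE c _
  ; const       = const isE
  }

EFn-isExpectation : ∀ {X} {E : Expectation X} → IsExpectation E → ∀ a → IsExpectation (EFn E a)
EFn-isExpectation isE zero    = record
  { ext = λ f≗g → f≗g _ ; additive = λ _ _ → refl ; homogeneous = λ _ _ → refl ; const = λ _ → refl }
EFn-isExpectation isE (suc a) =
  pushforward-isExpectation (λ p → cons (proj₁ p) (proj₂ p)) (⊗-isExpectation isE (EFn-isExpectation isE a))

Swappable : ∀ {X Y} → Expectation X → Expectation Y → Set
Swappable {X} {Y} E₁ E₂ = ∀ (g : X → Y → ℚ) → E₁ (λ x → E₂ (λ y → g x y)) ≡ E₂ (λ y → E₁ (λ x → g x y))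

EFn-swappable : ∀ {X Y} {E : Expectation X} {E′ : Expectation Y} →
                IsExpectation E → Swappable E E′ → ∀ a → Swappable (EFn E a) E′
EFn-swappable isE swap zero    g = refl
EFn-swappable {E = E} {E′} isE swap (suc a) g =
  trans (ext isE (λ x → EFn-swappable {E′ = E′} isE swap a (λ h → g (cons x h))))
        (swap (λ x y → EFn E a (λ h → g (cons x h) y)))

sumℚ-cong : ∀ k {f g : Fin k → ℚ} → (∀ i → f i ≡ g i) → sumℚ k f ≡ sumℚ k g
sumℚ-cong zero    f≗g = refl
sumℚ-cong (suc k) f≗g = cong₂ _+_ (f≗g Fin.zero) (sumℚ-cong k (λ i → f≗g (Fin.suc i)))

sumℚ-+ : ∀ k (f g : Fin k → ℚ) → sumℚ k (λ i → f i + g i) ≡ sumℚ k f + sumℚ k g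
sumℚ-+ zero    f g = refl
sumℚ-+ (suc k) f g = trans (cong (_+_ (f Fin.zero + g Fin.zero)) (sumℚ-+ k _ _))
  (solve 4 (λ a b c d → (a :+ b) :+ (c :+ d) := (a :+ c) :+ (b :+ d)) refl
     (f Fin.zero) (g Fin.zero) (sumℚ k (λ i → f (Fin.suc i))) (sumℚ k (λ i → g (Fin.suc i))))

sumℚ-*ˡ : ∀ k c (f : Fin k → ℚ) → sumℚ k (λ i → c * f i) ≡ c * sumℚ k f
sumℚ-*ˡ zero    c f = sym (ℚP.*-zeroʳ c)
sumℚ-*ˡ (suc k) c f = trans (cong (_+_ (c * f Fin.zero)) (sumℚ-*ˡ k c _)) (sym (ℚP.*-distribˡ-+ c _ _))

sumℚ-const : ∀ k c → sumℚ k (λ _ → c) ≡ ℕtoℚ k * c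
sumℚ-const zero    c = sym (ℚP.*-zeroˡ c)
sumℚ-const (suc k) c = begin
  c + sumℚ k (λ _ → c)    ≡⟨ cong (_+_ c) (sumℚ-const k c) ⟩
  c + ℕtoℚ k * c          ≡⟨ solve 2 (λ c k → c :+ k :* c := (con 1ℚ :+ k) :* c) refl c (ℕtoℚ k) ⟩
  (1ℚ + ℕtoℚ k) * c       ≡⟨ cong (_* c) (ℕtoℚ-+ 1 k) ⟨
  ℕtoℚ (suc k) * c        ∎
  where open ≡-Reasoning

sumℚ-single : ∀ k (f : Fin k → ℚ) j → (∀ i → i ≢ j → f i ≡ 0ℚ) → sumℚ k f ≡ f j
sumℚ-single (suc k) f Fin.zero others≡0 = begin
  f Fin.zero + sumℚ k (λ i → f (Fin.suc i))   ≡⟨ cong (_+_ (f Fin.zero)) (sumℚ-cong k (λ i → others≡0 (Fin.suc i) (λ ()))) ⟩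
  f Fin.zero + sumℚ k (λ _ → 0ℚ)              ≡⟨ cong (_+_ (f Fin.zero)) (trans (sumℚ-const k 0ℚ) (ℚP.*-zeroʳ (ℕtoℚ k))) ⟩
  f Fin.zero + 0ℚ                             ≡⟨ ℚP.+-identityʳ (f Fin.zero) ⟩
  f Fin.zero                                  ∎
  where open ≡-Reasoning
sumℚ-single (suc k) f (Fin.suc j) others≡0 =
  trans (cong₂ _+_ (others≡0 Fin.zero (λ ())) (sumℚ-single k (λ i → f (Fin.suc i)) j (λ i i≢j → others≡0 (Fin.suc i) (i≢j ∘ FinP.suc-injective))))
        (ℚP.+-identityˡ (f (Fin.suc j)))

sumℚ-swappable : ∀ {Y} {E : Expectation Y} → IsExpectation E →
                 ∀ k (g : Fin k → Y → ℚ) → E (λ y → sumℚ k (λ i → g i y)) ≡ sumℚ k (λ i → E (g i))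
sumℚ-swappable isE zero    g = const isE 0ℚ
sumℚ-swappable {E = E} isE (suc k) g =
  trans (additive isE (g Fin.zero) _) (cong (_+_ (E (g Fin.zero))) (sumℚ-swappable isE k (λ i → g (Fin.suc i))))

prodℚ : (k : ℕ) → (Fin k → ℚ) → ℚ
prodℚ zero    f = 1ℚ
prodℚ (suc k) f = f Fin.zero * prodℚ k (λ i → f (Fin.suc i))

prodℚ-ones : ∀ k {f : Fin k → ℚ} → (∀ i → f i ≡ 1ℚ) → prodℚ k f ≡ 1ℚ
prodℚ-ones zero    f≡1 = refl
prodℚ-ones (suc k) f≡1 = cong₂ _*_ (f≡1 Fin.zero) (prodℚ-ones k (f≡1 ∘ Fin.suc))

prodℚ-zero : ∀ k {f : Fin k → ℚ} i → f i ≡ 0ℚ → prodℚ k f ≡ 0ℚ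
prodℚ-zero (suc k) {f} Fin.zero    fᵢ≡0 = trans (cong (_* prodℚ k (f ∘ Fin.suc)) fᵢ≡0) (ℚP.*-zeroˡ (prodℚ k (f ∘ Fin.suc)))
prodℚ-zero (suc k) {f} (Fin.suc i) fᵢ≡0 = trans (cong (f Fin.zero *_) (prodℚ-zero k i fᵢ≡0)) (ℚP.*-zeroʳ (f Fin.zero))

EFn-prodℚ : ∀ {X} {E : Expectation X} → IsExpectation E →
            ∀ a (f : X → ℚ) → EFn E a (λ h → prodℚ a (λ i → f (h i))) ≡ E f ^ℚ a
EFn-prodℚ isE zero    f = refl
EFn-prodℚ {E = E} isE (suc a) f = begin
  E (λ x → EFn E a (λ h → f x * prodℚ a (λ i → f (h i))))   ≡⟨ ext isE (λ x → homogeneous (EFn-isExpectation isE a) (f x) _) ⟩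
  E (λ x → f x * EFn E a (λ h → prodℚ a (λ i → f (h i))))   ≡⟨ ext isE (λ x → cong (f x *_) (EFn-prodℚ isE a f)) ⟩
  E (λ x → f x * E f ^ℚ a)                                  ≡⟨ homogeneousʳ isE (E f ^ℚ a) f ⟩
  E f * E f ^ℚ a                                            ∎
  where open ≡-Reasoning

module EquationSolving {c ℓ} (R : CommutativeRing c ℓ) where
  private
    module R = CommutativeRing R
  open CommutativeRing R using (_≈_; 0#; 1#)

  ≈-sym-⇔ : ∀ {a b} → (a ≈ b) ⇔ (b ≈ a)
  ≈-sym-⇔ = mk⇔ R.sym R.sym

  ≈-transˡ-⇔ : ∀ {a b c} → a ≈ b → (a ≈ c) ⇔ (b ≈ c)
  ≈-transˡ-⇔ a≈b = mk⇔ (R.trans (R.sym a≈b)) (R.trans a≈b)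

  +-solveˡ : ∀ {a y c} → (a R.+ y ≈ c) ⇔ (y ≈ c R.- a)
  +-solveˡ {a} {y} {c} = mk⇔ to from
    where
    open import Relation.Binary.Reasoning.Setoid R.setoid
    open import Algebra.Properties.Group R.+-group using (\\-leftDividesˡ; \\-leftDividesʳ)
    to : a R.+ y ≈ c → y ≈ c R.- a
    to a+y≈c = begin
      y                      ≈⟨ \\-leftDividesʳ a y ⟨
      R.- a R.+ (a R.+ y)    ≈⟨ R.+-congˡ a+y≈c ⟩
      R.- a R.+ c            ≈⟨ R.+-comm (R.- a) c ⟩
      c R.- a                ∎
    from : y ≈ c R.- a → a R.+ y ≈ c
    from y≈c-a = begin
      a R.+ y                ≈⟨ R.+-congˡ (R.trans y≈c-a (R.+-comm c (R.- a))) ⟩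
      a R.+ (R.- a R.+ c)    ≈⟨ \\-leftDividesˡ a c ⟩
      c                      ∎

  -≈0⇔≈ : ∀ {a c} → (c R.- a ≈ 0#) ⇔ (a ≈ c)
  -≈0⇔≈ = mk⇔ (λ c-a≈0 → R.sym (x∙y⁻¹≈ε⇒x≈y _ _ c-a≈0)) (λ a≈c → x≈y⇒x∙y⁻¹≈ε (R.sym a≈c))
    where open import Algebra.Properties.Group R.+-group using (x∙y⁻¹≈ε⇒x≈y; x≈y⇒x∙y⁻¹≈ε)

  *-solveˡ : ∀ {a b y c} → a R.* b ≈ 1# → (a R.* y ≈ c) ⇔ (y ≈ b R.* c)
  *-solveˡ {a} {b} {y} {c} ab≈1 = mk⇔ to from
    where
    open import Relation.Binary.Reasoning.Setoid R.setoid
    to : a R.* y ≈ c → y ≈ b R.* c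
    to ay≈c = begin
      y                  ≈⟨ R.*-identityˡ y ⟨
      1# R.* y           ≈⟨ R.*-congʳ (R.trans (R.sym ab≈1) (R.*-comm a b)) ⟩
      (b R.* a) R.* y    ≈⟨ R.*-assoc b a y ⟩
      b R.* (a R.* y)    ≈⟨ R.*-congˡ ay≈c ⟩
      b R.* c            ∎
    from : y ≈ b R.* c → a R.* y ≈ c
    from y≈bc = begin
      a R.* y            ≈⟨ R.*-congˡ y≈bc ⟩
      a R.* (b R.* c)    ≈⟨ R.*-assoc a b c ⟨
      (a R.* b) R.* c    ≈⟨ R.*-congʳ ab≈1 ⟩
      1# R.* c           ≈⟨ R.*-identityˡ c ⟩
      c                  ∎

  zero-*-⇔ : ∀ {a y c} → a ≈ 0# → (a R.* y ≈ c) ⇔ (c ≈ 0#)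
  zero-*-⇔ {a} {y} a≈0 = mk⇔ (λ ay≈c → R.trans (R.sym ay≈c) ay≈0) (λ c≈0 → R.trans ay≈0 (R.sym c≈0))
    where
    ay≈0 : a R.* y ≈ 0#
    ay≈0 = R.trans (R.*-congʳ a≈0) (R.zeroˡ y)

module _ (𝔽 : FiniteField) where
  open FiniteField 𝔽 using (Carrier; _≈_; _≟_; 0#; 1#; size; elem; elem-surj; elem-inj; inverse; 1≉0)
  private
    module F = FiniteField 𝔽
  open EquationSolving F.commRing

  q⁻¹ : ℚ
  q⁻¹ = + 1 / size

  2≤size : 2 ℕ.≤ size
  2≤size = s≤s (1≤pred elem elem-surj)
    where
    1≤pred : ∀ {k} (e : Fin (suc k) → Carrier) → (∀ x → ∃ λ i → e i ≈ x) → 1 ℕ.≤ k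
    1≤pred {zero} e surj with surj 0# | surj 1#
    ... | Fin.zero , e₀≈0 | Fin.zero , e₀≈1 = contradiction (F.trans (F.sym e₀≈1) e₀≈0) 1≉0
    1≤pred {suc k} _ _ = s≤s z≤n

  𝟙 : Carrier → Carrier → ℚ
  𝟙 = 𝟙≈ 𝔽

  𝟙-≈ : ∀ {a b} → a ≈ b → 𝟙 a b ≡ 1ℚ
  𝟙-≈ {a} {b} a≈b with a ≟ b
  ... | yes _   = refl
  ... | no a≉b = contradiction a≈b a≉b

  𝟙-≉ : ∀ {a b} → ¬ a ≈ b → 𝟙 a b ≡ 0ℚ
  𝟙-≉ {a} {b} a≉b with a ≟ b
  ... | yes a≈b = contradiction a≈b a≉b
  ... | no _    = refl

  𝟙-cong : ∀ {a b a′ b′} → (a ≈ b ⇔ a′ ≈ b′) → 𝟙 a b ≡ 𝟙 a′ b′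
  𝟙-cong {a} {b} {a′} {b′} a≈b⇔a′≈b′ with a ≟ b | a′ ≟ b′
  ... | yes _   | yes _     = refl
  ... | no _    | no _      = refl
  ... | yes a≈b | no a′≉b′  = contradiction (Equivalence.to a≈b⇔a′≈b′ a≈b) a′≉b′
  ... | no a≉b  | yes a′≈b′ = contradiction (Equivalence.from a≈b⇔a′≈b′ a′≈b′) a≉b

  E𝔽-isExpectation : IsExpectation (E𝔽 𝔽)
  E𝔽-isExpectation = record
    { ext         = λ f≗g → cong (_* q⁻¹) (sumℚ-cong size f≗g)
    ; additive    = λ f g → trans (cong (_* q⁻¹) (sumℚ-+ size f g)) (ℚP.*-distribʳ-+ q⁻¹ (sumℚ size f) (sumℚ size g))
    ; homogeneous = λ c f → trans (cong (_* q⁻¹) (sumℚ-*ˡ size c f)) (ℚP.*-assoc c _ q⁻¹)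
    ; const       = λ c → begin
        sumℚ size (λ _ → c) * q⁻¹   ≡⟨ cong (_* q⁻¹) (sumℚ-const size c) ⟩
        ℕtoℚ size * c * q⁻¹         ≡⟨ solve 3 (λ k c i → k :* c :* i := (k :* i) :* c) refl (ℕtoℚ size) c q⁻¹ ⟩
        ℕtoℚ size * q⁻¹ * c         ≡⟨ cong (_* c) (ℕtoℚ*1/ size) ⟩
        1ℚ * c                      ≡⟨ ℚP.*-identityˡ c ⟩
        c                           ∎
    }
    where open ≡-Reasoning

  E𝔽-swappable : ∀ {Y} {E : Expectation Y} → IsExpectation E → Swappable (E𝔽 𝔽) E
  E𝔽-swappable {E = E} isE g = begin
    sumℚ size (λ u → E (g u)) * q⁻¹              ≡⟨ cong (_* q⁻¹) (sumℚ-swappable isE size g) ⟨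
    E (λ y → sumℚ size (λ u → g u y)) * q⁻¹      ≡⟨ homogeneousʳ isE q⁻¹ _ ⟨
    E (λ y → sumℚ size (λ u → g u y) * q⁻¹)      ∎
    where open ≡-Reasoning

  Pr : ∀ {X} → Expectation X → (X → Carrier) → Carrier → ℚ
  Pr E Y c = E (λ s → 𝟙 (Y s) c)

  Pr-cong : ∀ {X} {E : Expectation X} {Y Y′ : X → Carrier} {c c′} → IsExpectation E →
            (∀ s → (Y s ≈ c) ⇔ (Y′ s ≈ c′)) → Pr E Y c ≡ Pr E Y′ c′
  Pr-cong isE Ys≈c⇔Y′s≈c′ = ext isE (λ s → 𝟙-cong (Ys≈c⇔Y′s≈c′ s))

  Uniform : ∀ {X} → Expectation X → (X → Carrier) → Set
  Uniform E Y = ∀ c → Pr E Y c ≡ q⁻¹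

  elem-uniform : Uniform (E𝔽 𝔽) elem
  elem-uniform c = begin
    sumℚ size (λ v → 𝟙 (elem v) c) * q⁻¹   ≡⟨ cong (_* q⁻¹) (sumℚ-single size _ i (λ v v≢i → 𝟙-≉ (v≢i ∘ elem≈c⇒≡i))) ⟩
    𝟙 (elem i) c * q⁻¹                    ≡⟨ cong (_* q⁻¹) (𝟙-≈ elemi≈c) ⟩
    1ℚ * q⁻¹                              ≡⟨ ℚP.*-identityˡ q⁻¹ ⟩
    q⁻¹                                   ∎
    where
    open ≡-Reasoning
    i : Fin size
    i = proj₁ (elem-surj c)
    elemi≈c : elem i ≈ c
    elemi≈c = proj₂ (elem-surj c)
    elem≈c⇒≡i : ∀ {v} → elem v ≈ c → v ≡ i
    elem≈c⇒≡i elemv≈c = elem-inj _ i (F.trans elemv≈c (F.sym elemi≈c))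

  uniform-+ˡ : ∀ {X} {E : Expectation X} {Y} → IsExpectation E → Uniform E Y → ∀ a → Uniform E (λ s → a F.+ Y s)
  uniform-+ˡ isE unif a c = trans (Pr-cong isE (λ _ → +-solveˡ)) (unif (c F.- a))

  uniform-*ˡ : ∀ {X} {E : Expectation X} {Y} → IsExpectation E → Uniform E Y → ∀ {a} → ¬ a ≈ 0# → Uniform E (λ s → a F.* Y s)
  uniform-*ˡ isE unif {a} a≉0 c = trans (Pr-cong isE (λ _ → *-solveˡ (proj₂ (inverse a a≉0)))) (unif _)

  uniform-+-independent : ∀ {X Y} {E₁ : Expectation X} {E₂ : Expectation Y} {Y₂} → IsExpectation E₁ → IsExpectation E₂ →
                          Uniform E₂ Y₂ → ∀ (Y₁ : X → Carrier) → Uniform (E₁ ⊗ E₂) (λ p → Y₁ (proj₁ p) F.+ Y₂ (proj₂ p))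
  uniform-+-independent isE₁ isE₂ unif₂ Y₁ c = trans (ext isE₁ (λ x → uniform-+ˡ isE₂ unif₂ (Y₁ x) c)) (const isE₁ q⁻¹)

  ZeroBiased : ∀ {X} → Expectation X → (X → Carrier) → ℚ → Set
  ZeroBiased E Y D = ∃ λ B → ∀ c → Pr E Y c ≡ B + D * 𝟙 c 0#

  zeroBiased-bias : ∀ {X} {E : Expectation X} {Y D} → IsExpectation E → ZeroBiased E Y D →
                    E (λ s → 𝟙 (Y s) 0# - 𝟙 (Y s) 1#) ≡ D
  zeroBiased-bias {E = E} {Y} {D} isE (B , law) = begin
    E (λ s → 𝟙 (Y s) 0# - 𝟙 (Y s) 1#)       ≡⟨ subtractive isE (λ s → 𝟙 (Y s) 0#) (λ s → 𝟙 (Y s) 1#) ⟩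
    Pr E Y 0# - Pr E Y 1#                   ≡⟨ cong₂ _-_ (law 0#) (law 1#) ⟩
    (B + D * 𝟙 0# 0#) - (B + D * 𝟙 1# 0#)   ≡⟨ cong₂ (λ u v → (B + D * u) - (B + D * v)) (𝟙-≈ F.refl) (𝟙-≉ 1≉0) ⟩
    (B + D * 1ℚ) - (B + D * 0ℚ)             ≡⟨ solve 2 (λ B D → (B :+ D :* con 1ℚ) :- (B :+ D :* con 0ℚ) := D) refl B D ⟩
    D                                       ∎
    where open ≡-Reasoning

  Pr-scaled-uniform : ∀ {X} {E : Expectation X} {Y} → IsExpectation E → Uniform E Y →
                      ∀ a c → Pr E (λ s → a F.* Y s) c ≡ q⁻¹ + (𝟙 c 0# - q⁻¹) * 𝟙 a 0#
  Pr-scaled-uniform {E = E} {Y} isE unif a c with a ≟ 0#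
  ... | yes a≈0 = begin
    Pr E (λ s → a F.* Y s) c   ≡⟨ ext isE (λ s → 𝟙-cong (zero-*-⇔ a≈0)) ⟩
    E (λ _ → 𝟙 c 0#)           ≡⟨ const isE (𝟙 c 0#) ⟩
    𝟙 c 0#                     ≡⟨ solve 2 (λ z i → z := i :+ (z :- i) :* con 1ℚ) refl (𝟙 c 0#) q⁻¹ ⟩
    q⁻¹ + (𝟙 c 0# - q⁻¹) * 1ℚ  ∎
    where open ≡-Reasoning
  ... | no a≉0 = trans (uniform-*ˡ isE unif a≉0 c) (solve 2 (λ z i → i := i :+ (z :- i) :* con 0ℚ) refl (𝟙 c 0#) q⁻¹)

  zeroBiased-* : ∀ {X Y} {E₁ : Expectation X} {E₂ : Expectation Y} {Y₁ Y₂} → IsExpectation E₁ → IsExpectation E₂ →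
                 Uniform E₁ Y₁ → Uniform E₂ Y₂ → ZeroBiased (E₁ ⊗ E₂) (λ p → Y₁ (proj₁ p) F.* Y₂ (proj₂ p)) q⁻¹
  zeroBiased-* {E₁ = E₁} {E₂} {Y₁} {Y₂} isE₁ isE₂ unif₁ unif₂ = q⁻¹ - q⁻¹ * q⁻¹ , λ c → begin
    E₁ (λ x → Pr E₂ (λ y → Y₁ x F.* Y₂ y) c)           ≡⟨ ext isE₁ (λ x → Pr-scaled-uniform isE₂ unif₂ (Y₁ x) c) ⟩
    E₁ (λ x → q⁻¹ + (𝟙 c 0# - q⁻¹) * 𝟙 (Y₁ x) 0#)     ≡⟨ affine isE₁ q⁻¹ (𝟙 c 0# - q⁻¹) (λ x → 𝟙 (Y₁ x) 0#) ⟩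
    q⁻¹ + (𝟙 c 0# - q⁻¹) * Pr E₁ Y₁ 0#                 ≡⟨ cong (λ t → q⁻¹ + (𝟙 c 0# - q⁻¹) * t) (unif₁ 0#) ⟩
    q⁻¹ + (𝟙 c 0# - q⁻¹) * q⁻¹                         ≡⟨ solve 2 (λ i z → i :+ (z :- i) :* i := (i :- i :* i) :+ i :* z) refl q⁻¹ (𝟙 c 0#) ⟩
    (q⁻¹ - q⁻¹ * q⁻¹) + q⁻¹ * 𝟙 c 0#                   ∎
    where open ≡-Reasoning

  zeroBiased-+ : ∀ {X Y} {E₁ : Expectation X} {E₂ : Expectation Y} {Y₁ Y₂ D₁ D₂} → IsExpectation E₁ → IsExpectation E₂ →
                 ZeroBiased E₁ Y₁ D₁ → ZeroBiased E₂ Y₂ D₂ → ZeroBiased (E₁ ⊗ E₂) (λ p → Y₁ (proj₁ p) F.+ Y₂ (proj₂ p)) (D₁ * D₂)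
  zeroBiased-+ {E₁ = E₁} {E₂} {Y₁} {Y₂} {D₁} {D₂} isE₁ isE₂ (B₁ , law₁) (B₂ , law₂) = B₂ + D₂ * B₁ , λ c → begin
    E₁ (λ x → Pr E₂ (λ y → Y₁ x F.+ Y₂ y) c)   ≡⟨ ext isE₁ (λ x → trans (Pr-cong isE₂ (λ _ → +-solveˡ)) (law₂ (c F.- Y₁ x))) ⟩
    E₁ (λ x → B₂ + D₂ * 𝟙 (c F.- Y₁ x) 0#)     ≡⟨ ext isE₁ (λ x → cong (λ t → B₂ + D₂ * t) (𝟙-cong -≈0⇔≈)) ⟩
    E₁ (λ x → B₂ + D₂ * 𝟙 (Y₁ x) c)            ≡⟨ affine isE₁ B₂ D₂ (λ x → 𝟙 (Y₁ x) c) ⟩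
    B₂ + D₂ * Pr E₁ Y₁ c                       ≡⟨ cong (λ t → B₂ + D₂ * t) (law₁ c) ⟩
    B₂ + D₂ * (B₁ + D₁ * 𝟙 c 0#)               ≡⟨ solve 5 (λ b₁ b₂ d₁ d₂ z → b₂ :+ d₂ :* (b₁ :+ d₁ :* z) := (b₂ :+ d₂ :* b₁) :+ d₁ :* d₂ :* z)
                                                        refl B₁ B₂ D₁ D₂ (𝟙 c 0#) ⟩
    (B₂ + D₂ * B₁) + D₁ * D₂ * 𝟙 c 0#          ∎
    where open ≡-Reasoning

  NonzeroVector : ∀ {m} → (Fin m → Carrier) → Set
  NonzeroVector v = ∃ λ j → ¬ v j ≈ 0#

  ¬zero⇒nonzero : ∀ {m} {v : Fin m → Carrier} → ¬ (∀ j → v j ≈ 0#) → NonzeroVector v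
  ¬zero⇒nonzero {m} {v} = FinP.¬∀⟶∃¬ m (λ j → v j ≈ 0#) (λ j → v j ≟ 0#)

  sum𝔽-zero : ∀ m {f : Fin m → Carrier} → (∀ j → f j ≈ 0#) → sum𝔽 𝔽 m f ≈ 0#
  sum𝔽-zero zero    f≈0 = F.refl
  sum𝔽-zero (suc m) f≈0 = F.trans (F.+-cong (f≈0 Fin.zero) (sum𝔽-zero m (f≈0 ∘ Fin.suc))) (F.+-identityˡ 0#)

  linearCombination-uniform : ∀ {X} {E : Expectation X} {Y} → IsExpectation E → Uniform E Y →
                              ∀ m (v : Fin m → Carrier) → NonzeroVector v →
                              Uniform (EFn E m) (λ h → sum𝔽 𝔽 m (λ j → v j F.* Y (h j)))
  linearCombination-uniform {X} {E} {Y} isE unif (suc m) v v≉0 with FinP.all? (λ j → v (Fin.suc j) ≟ 0#)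
  ... | no tail≉0  = uniform-+-independent isE (EFn-isExpectation isE m)
                       (linearCombination-uniform isE unif m (v ∘ Fin.suc) (¬zero⇒nonzero tail≉0)) (λ y → v Fin.zero F.* Y y)
  ... | yes tail≈0 = λ c → begin
    Pr (EFn E (suc m)) Z c                                ≡⟨ Pr-cong (EFn-isExpectation isE (suc m)) (λ h → ≈-transˡ-⇔ (Z≈head h)) ⟩
    E (λ y → EFn E m (λ _ → 𝟙 (v Fin.zero F.* Y y) c))   ≡⟨ ext isE (λ y → const (EFn-isExpectation isE m) _) ⟩
    Pr E (λ y → v Fin.zero F.* Y y) c                     ≡⟨ uniform-*ˡ isE unif (head≉0 v≉0) c ⟩
    q⁻¹                                                   ∎
    where
    open ≡-Reasoning
    Z : (Fin (suc m) → X) → Carrier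
    Z h = sum𝔽 𝔽 (suc m) (λ j → v j F.* Y (h j))
    Z≈head : ∀ h → Z h ≈ v Fin.zero F.* Y (h Fin.zero)
    Z≈head h = F.trans (F.+-congˡ (sum𝔽-zero m (λ j → F.trans (F.*-congʳ (tail≈0 j)) (F.zeroˡ _))))
                       (F.+-identityʳ _)
    head≉0 : NonzeroVector v → ¬ v Fin.zero ≈ 0#
    head≉0 (Fin.zero  , v₀≉0) = v₀≉0
    head≉0 (Fin.suc j , vⱼ≉0) = contradiction (tail≈0 j) vⱼ≉0

  module _ (n : ℕ) where

    EForm-isExpectation : ∀ {d} (p : Subset d) → IsExpectation (EForm 𝔽 n p)
    EForm-isExpectation []          = E𝔽-isExpectation
    EForm-isExpectation (true ∷ p)  = EFn-isExpectation (EForm-isExpectation p) n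
    EForm-isExpectation (false ∷ p) = EForm-isExpectation p

    EConfig-isExpectation : ∀ {d} r (I : Fin r → Subset d) → IsExpectation (EConfig 𝔽 n r I)
    EConfig-isExpectation zero    I = record
      { ext = λ f≗g → f≗g _ ; additive = λ _ _ → refl ; homogeneous = λ _ _ → refl ; const = λ _ → refl }
    EConfig-isExpectation (suc r) I =
      pushforward-isExpectation (λ p → consD {P = λ i → Form 𝔽 n (I i) × Form 𝔽 n (∁ (I i))} (proj₁ p) (proj₂ p))
        (⊗-isExpectation (⊗-isExpectation (EForm-isExpectation (I Fin.zero)) (EForm-isExpectation (∁ (I Fin.zero))))
                         (EConfig-isExpectation r (I ∘ Fin.suc)))

    AllNonzero : ∀ {d} → Point 𝔽 d n → Set
    AllNonzero x = ∀ k → NonzeroVector (x k)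

    evalForm-uniform : ∀ {d} (p : Subset d) {x : Point 𝔽 d n} → AllNonzero x →
                       Uniform (EForm 𝔽 n p) (λ s → evalForm 𝔽 n p s x)
    evalForm-uniform []              x≉0 = elem-uniform
    evalForm-uniform (true ∷ p)  {x} x≉0 = linearCombination-uniform (EForm-isExpectation p)
      (evalForm-uniform p {x ∘ Fin.suc} (x≉0 ∘ Fin.suc)) n (x Fin.zero) (x≉0 Fin.zero)
    evalForm-uniform (false ∷ p) {x} x≉0 = evalForm-uniform p {x ∘ Fin.suc} (x≉0 ∘ Fin.suc)

    evalForm-vanishes : ∀ {d} {p : Subset d} {k} (x : Point 𝔽 d n) → k ∈ p → (∀ j → x k j ≈ 0#) →
                        ∀ s → evalForm 𝔽 n p s x ≈ 0#
    evalForm-vanishes {p = true ∷ p}  x here        xₖ≈0 s =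
      sum𝔽-zero n (λ j → F.trans (F.*-congʳ (xₖ≈0 j)) (F.zeroˡ _))
    evalForm-vanishes {p = true ∷ p}  x (there k∈p) xₖ≈0 s =
      sum𝔽-zero n (λ j → F.trans (F.*-congˡ (evalForm-vanishes (x ∘ Fin.suc) k∈p xₖ≈0 (s j))) (F.zeroʳ _))
    evalForm-vanishes {p = false ∷ p} x (there k∈p) xₖ≈0 s = evalForm-vanishes (x ∘ Fin.suc) k∈p xₖ≈0 s

    reducible-vanishes : ∀ {d} (p : Subset d) {k} (x : Point 𝔽 d n) → (∀ j → x k j ≈ 0#) →
                         ∀ s t → evalForm 𝔽 n p s x F.* evalForm 𝔽 n (∁ p) t x ≈ 0#
    reducible-vanishes p {k} x xₖ≈0 s t with k ∈? p
    ... | yes k∈p = F.trans (F.*-congʳ (evalForm-vanishes x k∈p xₖ≈0 s)) (F.zeroˡ _)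
    ... | no k∉p  = F.trans (F.*-congˡ (evalForm-vanishes x (x∉p⇒x∈∁p k∉p) xₖ≈0 t)) (F.zeroʳ _)

    tensor-vanishes : ∀ {d} r (I : Fin r → Subset d) (x : Point 𝔽 d n) {k} → (∀ j → x k j ≈ 0#) →
                      ∀ c → tensor 𝔽 d n r I c x ≈ 0#
    tensor-vanishes r I x xₖ≈0 c =
      sum𝔽-zero r (λ i → reducible-vanishes (I i) x xₖ≈0 (proj₁ (c i)) (proj₂ (c i)))

    tensor-zeroBiased : ∀ {d} {x : Point 𝔽 d n} → AllNonzero x →
                        ∀ r (I : Fin r → Subset d) → ZeroBiased (EConfig 𝔽 n r I) (λ c → tensor 𝔽 d n r I c x) (q⁻¹ ^ℚ r)
    tensor-zeroBiased x≉0 zero    I = 0ℚ , λ c →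
      trans (𝟙-cong ≈-sym-⇔) (sym (trans (ℚP.+-identityˡ _) (ℚP.*-identityˡ _)))
    tensor-zeroBiased x≉0 (suc r) I = zeroBiased-+ {D₁ = q⁻¹} {D₂ = q⁻¹ ^ℚ r}
      (⊗-isExpectation (EForm-isExpectation (I Fin.zero)) (EForm-isExpectation (∁ (I Fin.zero))))
      (EConfig-isExpectation r (I ∘ Fin.suc))
      (zeroBiased-* (EForm-isExpectation (I Fin.zero)) (EForm-isExpectation (∁ (I Fin.zero)))
                    (evalForm-uniform (I Fin.zero) x≉0) (evalForm-uniform (∁ (I Fin.zero)) x≉0))
      (tensor-zeroBiased x≉0 r (I ∘ Fin.suc))

    allNonzero⊎someZero : ∀ {d} (x : Point 𝔽 d n) → AllNonzero x ⊎ ∃ λ k → ∀ j → x k j ≈ 0#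
    allNonzero⊎someZero x with FinP.any? (λ k → FinP.all? (λ j → x k j ≟ 0#))
    ... | yes someZero = inj₂ someZero
    ... | no ¬someZero = inj₁ (λ k → ¬zero⇒nonzero (λ xₖ≈0 → ¬someZero (k , xₖ≈0)))

    -- a product over k, so that its expectation over the independent x⁽ᵏ⁾ factorises
    allNonzero𝟙 : ∀ {d} → Point 𝔽 d n → ℚ
    allNonzero𝟙 {d} x = prodℚ d (λ k → 1ℚ - prodℚ n (λ j → 𝟙 (x k j) 0#))

    allNonzero𝟙-≡1 : ∀ {d} {x : Point 𝔽 d n} → AllNonzero x → allNonzero𝟙 x ≡ 1ℚ
    allNonzero𝟙-≡1 {d} x≉0 =
      prodℚ-ones d (λ k → cong (λ t → 1ℚ - t) (prodℚ-zero n (proj₁ (x≉0 k)) (𝟙-≉ (proj₂ (x≉0 k)))))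

    allNonzero𝟙-≡0 : ∀ {d} {x : Point 𝔽 d n} {k} → (∀ j → x k j ≈ 0#) → allNonzero𝟙 x ≡ 0ℚ
    allNonzero𝟙-≡0 {d} {k = k} xₖ≈0 =
      prodℚ-zero d k (cong (λ t → 1ℚ - t) (prodℚ-ones n (λ j → 𝟙-≈ (xₖ≈0 j))))

    pointwiseBias-formula : ∀ {d} r (I : Fin r → Subset d) (x : Point 𝔽 d n) →
                            EConfig 𝔽 n r I (λ c → 𝟙 (tensor 𝔽 d n r I c x) 0# - 𝟙 (tensor 𝔽 d n r I c x) 1#)
                              ≡ 1ℚ + (q⁻¹ ^ℚ r - 1ℚ) * allNonzero𝟙 x
    pointwiseBias-formula {d} r I x with allNonzero⊎someZero x
    ... | inj₁ x≉0 = begin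
      EConfig 𝔽 n r I (λ c → 𝟙 (T c) 0# - 𝟙 (T c) 1#)   ≡⟨ zeroBiased-bias (EConfig-isExpectation r I) (tensor-zeroBiased x≉0 r I) ⟩
      q⁻¹ ^ℚ r                                          ≡⟨ solve 1 (λ D → D := con 1ℚ :+ (D :- con 1ℚ) :* con 1ℚ) refl (q⁻¹ ^ℚ r) ⟩
      1ℚ + (q⁻¹ ^ℚ r - 1ℚ) * 1ℚ                         ≡⟨ cong (λ t → 1ℚ + (q⁻¹ ^ℚ r - 1ℚ) * t) (allNonzero𝟙-≡1 {x = x} x≉0) ⟨
      1ℚ + (q⁻¹ ^ℚ r - 1ℚ) * allNonzero𝟙 x              ∎
      where
      open ≡-Reasoning
      T : Config 𝔽 n r I → Carrier
      T c = tensor 𝔽 d n r I c x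
    ... | inj₂ (k , xₖ≈0) = begin
      EConfig 𝔽 n r I (λ c → 𝟙 (T c) 0# - 𝟙 (T c) 1#)   ≡⟨ ext (EConfig-isExpectation r I) (λ c → cong₂ _-_ (𝟙-≈ (T≈0 c)) (𝟙-≉ (T≉1 c))) ⟩
      EConfig 𝔽 n r I (λ _ → 1ℚ - 0ℚ)                   ≡⟨ const (EConfig-isExpectation r I) (1ℚ - 0ℚ) ⟩
      1ℚ - 0ℚ                                           ≡⟨ solve 1 (λ D → con 1ℚ :- con 0ℚ := con 1ℚ :+ (D :- con 1ℚ) :* con 0ℚ) refl (q⁻¹ ^ℚ r) ⟩
      1ℚ + (q⁻¹ ^ℚ r - 1ℚ) * 0ℚ                         ≡⟨ cong (λ t → 1ℚ + (q⁻¹ ^ℚ r - 1ℚ) * t) (allNonzero𝟙-≡0 {x = x} xₖ≈0) ⟨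
      1ℚ + (q⁻¹ ^ℚ r - 1ℚ) * allNonzero𝟙 x              ∎
      where
      open ≡-Reasoning
      T : Config 𝔽 n r I → Carrier
      T c = tensor 𝔽 d n r I c x
      T≈0 : ∀ c → T c ≈ 0#
      T≈0 = tensor-vanishes r I x xₖ≈0
      T≉1 : ∀ c → ¬ T c ≈ 1#
      T≉1 c T≈1 = 1≉0 (F.trans (F.sym T≈1) (T≈0 c))

    EPoint-allNonzero𝟙 : ∀ d → EPoint 𝔽 d n allNonzero𝟙 ≡ (1ℚ - q⁻¹ ^ℚ n) ^ℚ d
    EPoint-allNonzero𝟙 d = begin
      EPoint 𝔽 d n allNonzero𝟙      ≡⟨ EFn-prodℚ isE𝔽ⁿ d nonzero𝟙 ⟩
      EFn (E𝔽 𝔽) n nonzero𝟙 ^ℚ d   ≡⟨ cong (_^ℚ d) E-nonzero𝟙 ⟩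
      (1ℚ - q⁻¹ ^ℚ n) ^ℚ d         ∎
      where
      open ≡-Reasoning
      isE𝔽ⁿ : IsExpectation (EFn (E𝔽 𝔽) n)
      isE𝔽ⁿ = EFn-isExpectation E𝔽-isExpectation n
      nonzero𝟙 : (Fin n → Fin size) → ℚ
      nonzero𝟙 v = 1ℚ - prodℚ n (λ j → 𝟙 (elem (v j)) 0#)
      E-nonzero𝟙 : EFn (E𝔽 𝔽) n nonzero𝟙 ≡ 1ℚ - q⁻¹ ^ℚ n
      E-nonzero𝟙 = trans (subtractive isE𝔽ⁿ (λ _ → 1ℚ) _)
        (cong₂ _-_ (const isE𝔽ⁿ 1ℚ)
                   (trans (EFn-prodℚ E𝔽-isExpectation n (λ u → 𝟙 (elem u) 0#)) (cong (_^ℚ n) (elem-uniform 0#))))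

    expectedBias-formula : ∀ d r (I : Fin r → Subset d) →
                           expectedBias 𝔽 d n r I ≡ 1ℚ + (q⁻¹ ^ℚ r - 1ℚ) * (1ℚ - q⁻¹ ^ℚ n) ^ℚ d
    expectedBias-formula d r I = begin
      expectedBias 𝔽 d n r I                                       ≡⟨ swap (λ x c → integrand c (point x)) ⟨
      EPoint 𝔽 d n (λ x → EConfig 𝔽 n r I (λ c → integrand c x))   ≡⟨ ext isEPoint (λ x → pointwiseBias-formula r I x) ⟩
      EPoint 𝔽 d n (λ x → 1ℚ + (q⁻¹ ^ℚ r - 1ℚ) * allNonzero𝟙 x)   ≡⟨ affine isEPoint 1ℚ (q⁻¹ ^ℚ r - 1ℚ) allNonzero𝟙 ⟩
      1ℚ + (q⁻¹ ^ℚ r - 1ℚ) * EPoint 𝔽 d n allNonzero𝟙              ≡⟨ cong (λ t → 1ℚ + (q⁻¹ ^ℚ r - 1ℚ) * t) (EPoint-allNonzero𝟙 d) ⟩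
      1ℚ + (q⁻¹ ^ℚ r - 1ℚ) * (1ℚ - q⁻¹ ^ℚ n) ^ℚ d                  ∎
      where
      open ≡-Reasoning
      integrand : Config 𝔽 n r I → Point 𝔽 d n → ℚ
      integrand c x = 𝟙 (tensor 𝔽 d n r I c x) 0# - 𝟙 (tensor 𝔽 d n r I c x) 1#
      point : (Fin d → Fin n → Fin size) → Point 𝔽 d n
      point x k j = elem (x k j)
      isE𝔽ⁿ : IsExpectation (EFn (E𝔽 𝔽) n)
      isE𝔽ⁿ = EFn-isExpectation E𝔽-isExpectation n
      isEPoint : IsExpectation (EPoint 𝔽 d n)
      isEPoint = pushforward-isExpectation point (EFn-isExpectation isE𝔽ⁿ d)
      swap : Swappable (EFn (EFn (E𝔽 𝔽) n) d) (EConfig 𝔽 n r I)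
      swap = EFn-swappable {E′ = EConfig 𝔽 n r I} isE𝔽ⁿ
               (EFn-swappable {E′ = EConfig 𝔽 n r I} E𝔽-isExpectation (E𝔽-swappable (EConfig-isExpectation r I)) n) d

  relativeError-≤ : ∀ d n r (I : Fin r → Subset d) → r ℕ.≤ n →
                    ∣ expectedBias 𝔽 d n r I * ℕtoℚ (size ^ r) - 1ℚ ∣ ≤ ℕtoℚ d * q⁻¹ ^ℚ (n ℕ.∸ r)
  relativeError-≤ d n r I r≤n = begin
    ∣ expectedBias 𝔽 d n r I * Q - 1ℚ ∣       ≡⟨ cong (λ t → ∣ t * Q - 1ℚ ∣) (expectedBias-formula n d r I) ⟩
    ∣ (1ℚ + (q⁻¹ ^ℚ r - 1ℚ) * P) * Q - 1ℚ ∣   ≡⟨ cong ∣_∣ (relativeError-formula {Q} {q⁻¹ ^ℚ r} {P} Q*q⁻ʳ≡1) ⟩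
    ∣ (Q - 1ℚ) * (1ℚ - P) ∣                   ≡⟨ ℚP.0≤p⇒∣p∣≡p (0≤* (0≤q-p 1≤Q) 0≤1-P) ⟩
    (Q - 1ℚ) * (1ℚ - P)                       ≤⟨ *-monoʳ-≤ 0≤1-P (p-q≤p {Q} (ℚP.nonNegative⁻¹ 1ℚ)) ⟩
    Q * (1ℚ - P)                              ≤⟨ *-monoˡ-≤ (ℚP.≤-trans (ℚP.nonNegative⁻¹ 1ℚ) 1≤Q) (bernoulli 0≤a a≤1 d) ⟩
    Q * (ℕtoℚ d * a)                          ≡⟨ solve 3 (λ Q d a → Q :* (d :* a) := d :* (Q :* a)) refl Q (ℕtoℚ d) a ⟩
    ℕtoℚ d * (Q * a)                          ≡⟨ cong (ℕtoℚ d *_) Q*a≡q⁻ᵐ ⟩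
    ℕtoℚ d * q⁻¹ ^ℚ m                         ∎
    where
    open ℚP.≤-Reasoning
    m : ℕ
    m = n ℕ.∸ r
    Q : ℚ
    Q = ℕtoℚ (size ^ r)
    a : ℚ
    a = q⁻¹ ^ℚ n
    P : ℚ
    P = (1ℚ - a) ^ℚ d
    Q*q⁻ʳ≡1 : Q * q⁻¹ ^ℚ r ≡ 1ℚ
    Q*q⁻ʳ≡1 = trans (cong (_* q⁻¹ ^ℚ r) (ℕtoℚ-^ size r)) (^ℚ-inverse (ℕtoℚ*1/ size) r)
    Q*a≡q⁻ᵐ : Q * a ≡ q⁻¹ ^ℚ m
    Q*a≡q⁻ᵐ = begin-equality
      Q * q⁻¹ ^ℚ n                   ≡⟨ cong (λ k → Q * q⁻¹ ^ℚ k) (ℕP.m+[n∸m]≡n r≤n) ⟨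
      Q * q⁻¹ ^ℚ (r ℕ.+ m)           ≡⟨ cong (Q *_) (^ℚ-homo-+ q⁻¹ r m) ⟩
      Q * (q⁻¹ ^ℚ r * q⁻¹ ^ℚ m)      ≡⟨ ℚP.*-assoc Q _ _ ⟨
      Q * q⁻¹ ^ℚ r * q⁻¹ ^ℚ m        ≡⟨ cong (_* q⁻¹ ^ℚ m) Q*q⁻ʳ≡1 ⟩
      1ℚ * q⁻¹ ^ℚ m                  ≡⟨ ℚP.*-identityˡ _ ⟩
      q⁻¹ ^ℚ m                       ∎
    0≤a : 0ℚ ≤ a
    0≤a = proj₁ (^ℚ-bounds (proj₁ (1/-bounds size)) (proj₂ (1/-bounds size)) n)
    a≤1 : a ≤ 1ℚ
    a≤1 = proj₂ (^ℚ-bounds (proj₁ (1/-bounds size)) (proj₂ (1/-bounds size)) n)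
    0≤1-P : 0ℚ ≤ 1ℚ - P
    0≤1-P = 0≤q-p (proj₂ (^ℚ-bounds (0≤q-p a≤1) (p-q≤p 0≤a) d))
    1≤Q : 1ℚ ≤ Q
    1≤Q = ℕtoℚ-mono-≤ {1} (ℕP.m^n>0 size r)

-- The exact formula holds for every d and every choice of the subsets I_i.
theorem4p4 : (𝔽 : FiniteField) (d : ℕ) → 2 ℕ.≤ d →
    (ε : ℚ) → 0ℚ < ε →
    (r : ℕ → ℕ) → (I : (n : ℕ) → Fin (r n) → Subset d) →
    (∀ n i → Nonempty (I n i) × Nonempty (∁ (I n i))) →
    (∀ n → ℕtoℚ (r n) ≤ (1ℚ - ε) * ℕtoℚ n * ½) →
    ∀ (δ : ℚ) → 0ℚ < δ →
      ∃ λ (N : ℕ) → ∀ n → N ℕ.≤ n →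
        ∣ expectedBias 𝔽 d n (r n) (I n) * ℕtoℚ (FiniteField.size 𝔽 ^ r n) - 1ℚ ∣ ≤ δ
theorem4p4 𝔽 d _ ε 0<ε r I _ r≤[1-ε]n/2 δ 0<δ = 2 ℕ.* K , bound
  where
  K : ℕ
  K = d ℕ.* ↧ₙ δ
  bound : ∀ n → 2 ℕ.* K ℕ.≤ n → ∣ expectedBias 𝔽 d n (r n) (I n) * ℕtoℚ (FiniteField.size 𝔽 ^ r n) - 1ℚ ∣ ≤ δ
  bound n 2K≤n = ℚP.≤-trans
    (relativeError-≤ 𝔽 d n (r n) (I n) (ℕP.≤-trans (ℕP.m≤m+n (r n) (r n)) r+r≤n))
    (c*[1/q]^m≤δ (2≤size 𝔽) d 0<δ (half-≤-∸ {r = r n} r+r≤n 2K≤n))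
    where
    r+r≤n : r n ℕ.+ r n ℕ.≤ n
    r+r≤n = rate⇒r+r≤n 0<ε (r n) n (r≤[1-ε]n/2 n)
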